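{- Let $G=(V,E)$ be a simple connected chordal graph and let $\mathcal{A}(G)$ be the auxiliary graph defined in the context. Then there is a one-to-one correspondence between the co-3-plexes of $G$ and the stable sets of $\mathcal{A}(G)$, namely the map sending a stable set $\{L_1,\dots,L_\ell\}$ of $\mathcal{A}(G)$ to the vertex set $L_1\cup\dots\cup L_\ell$ of $G$ (whose inverse sends a co-3-plex $S$ to the family of vertex sets of the connected components of $G[S]$).
   Context: A co-3-plex of a graph $G$ is a subset $S\subseteq V$ such that the induced subgraph $G[S]$ has maximum degree at most $2$. A graph is chordal if it contains no induced cycle (hole) of length at least $4$. Let $\mathcal{T}(G)$ be the set of vertex sets of triangles of $G$ (3-element sets inducing a complete graph), and $\mathcal{I}(G)$ the set of vertex subsets of $G$ with at least two elements that induce a path (a set $\{v_1,\dots,v_p\}$ whose induced edge set is exactly $\{v_iv_{i+1}: 1\le i\le p-1\}$). The graph $\mathcal{A}(G)$ has vertex set $V\cup\mathcal{T}(G)\cup\mathcal{I}(G)$, where each $v\in V$ is identified with the singleton $\{v\}$; two distinct vertices $L,L'$ of $\mathcal{A}(G)$ are adjacent if and only if $G[L\cup L']$ is connected. -}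

module Defs where

open import Data.Nat using (ℕ; zero; suc; _+_; _≤_; _%_)
open import Data.Bool using (Bool; true; false)
open import Data.Fin using (Fin; toℕ)
open import Data.Fin.Subset using (Subset; _∈_; _∪_; _∩_; ∣_∣; Nonempty; ⊤; ⊥)
open import Data.Vec using (tabulate)
open import Data.List using (List; []; _∷_; foldr)
open import Data.List.Relation.Unary.All using (All)
open import Data.List.Relation.Unary.Unique.Propositional using (Unique)
import Data.List.Membership.Propositional as LM
open import Data.Product using (Σ; _×_; ∃)
open import Data.Sum using (_⊎_)
open import Relation.Binary.PropositionalEquality using (_≡_; _≢_)
open import Relation.Nullary using (¬_)
open import Function.Bundles using (_⇔_)
open import Function.Definitions using (Injective)

record Graph (n : ℕ) : Set where
  field
    adj     : Fin n → Fin n → Bool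
    adj-sym : ∀ u v → adj u v ≡ adj v u
    irrefl  : ∀ v → adj v v ≡ false

module _ {n : ℕ} (G : Graph n) where
  open Graph G

  E : Fin n → Fin n → Set
  E u v = adj u v ≡ true

  N : Fin n → Subset n
  N v = tabulate (adj v)

  data Reach (S : Subset n) : Fin n → Fin n → Set where
    here : ∀ {u} → u ∈ S → Reach S u u
    step : ∀ {u w v} → u ∈ S → E u w → Reach S w v → Reach S u v

  ConnectedSet : Subset n → Set
  ConnectedSet S = Nonempty S × (∀ u v → u ∈ S → v ∈ S → Reach S u v)

  Connected : Set
  Connected = ConnectedSet ⊤

  CycAdj : (k : ℕ) → Fin (suc k) → Fin (suc k) → Set
  CycAdj k i j = (suc (toℕ i) % suc k ≡ toℕ j) ⊎ (suc (toℕ j) % suc k ≡ toℕ i)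

  PathAdj : (p : ℕ) → Fin p → Fin p → Set
  PathAdj p i j = (suc (toℕ i) ≡ toℕ j) ⊎ (suc (toℕ j) ≡ toℕ i)

  Chordal : Set
  Chordal = ∀ (m : ℕ) (f : Fin (suc (suc (suc (suc m)))) → Fin n) → Injective _≡_ _≡_ f →
            ¬ (∀ i j → E (f i) (f j) ⇔ CycAdj (suc (suc (suc m))) i j)

  Co3Plex : Subset n → Set
  Co3Plex S = ∀ v → v ∈ S → ∣ S ∩ N v ∣ ≤ 2

  IsTriangle : Subset n → Set
  IsTriangle L = ∣ L ∣ ≡ 3 × (∀ u v → u ∈ L → v ∈ L → u ≢ v → E u v)

  IsInducedPath : Subset n → Set
  IsInducedPath L = Σ ℕ λ p → 2 ≤ p × Σ (Fin p → Fin n) λ f →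
      Injective _≡_ _≡_ f ×
      (∀ v → v ∈ L ⇔ ∃ λ i → f i ≡ v) ×
      (∀ i j → E (f i) (f j) ⇔ PathAdj p i j)

  IsSingleton : Subset n → Set
  IsSingleton L = ∣ L ∣ ≡ 1

  AVertex : Subset n → Set
  AVertex L = IsSingleton L ⊎ IsTriangle L ⊎ IsInducedPath L

  AAdj : Subset n → Subset n → Set
  AAdj L L' = L ≢ L' × ConnectedSet (L ∪ L')

  StableA : List (Subset n) → Set
  StableA Ls = Unique Ls × All AVertex Ls ×
               (∀ L L' → L LM.∈ Ls → L' LM.∈ Ls → ¬ AAdj L L')

⋃ : ∀ {n} → List (Subset n) → Subset n
⋃ = foldr _∪_ ⊥

_≈ₛ_ : ∀ {n} → List (Subset n) → List (Subset n) → Set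
Ls ≈ₛ Ms = ∀ L → (L LM.∈ Ls) ⇔ (L LM.∈ Ms)

-- If L₁, …, Lℓ are pairwise non-adjacent in 𝒜(G), an edge of G between two of them would make
-- their union connected; so each Lᵢ, being connected, is a whole connected component of
-- G[L₁ ∪ … ∪ Lℓ]. This gives the degree bound (singletons, triangles and induced paths have maximum
-- degree 2) and injectivity (a stable set is the set of components of its union). Conversely, the
-- components of G[S] for a co-3-plex S are built by adding the vertices of S one at a time: a new
-- vertex x touches at most two existing pieces, never a triangle and only at endpoints of paths, so
-- it extends a path, joins two paths, or is adjacent to both ends of one path, which must then be
-- an edge (giving a triangle), since a longer path would close into a hole.

module Submission where

open import Defs
open import Data.Bool using (true; false)
import Data.Bool.Properties as Bool
open import Data.Empty using (⊥; ⊥-elim)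
open import Data.Fin as Fin using (Fin; toℕ; fromℕ<; inject₁)
import Data.Fin.Properties as Fin
open import Data.Fin.Subset using (Subset; _∈_; _∪_; _∩_; _-_; _⊆_; ∣_∣; Nonempty; ⁅_⁆)
  renaming (⊥ to ∅)
open import Data.Fin.Subset.Properties
open import Data.List as List using (List; []; _∷_; _∷ʳ_; _ʳ++_; length; foldr)
open import Data.List.Membership.Propositional using (find; lose) renaming (_∈_ to _∈ₗ_; _∉_ to _∉ₗ_)
open import Data.List.Membership.Propositional.Properties
  using (∈-lookup; ∈-++⁺ʳ; ∈-filter⁺; ∈-filter⁻; ∈-map⁺; ∈-map⁻; ∈-allFin)
import Data.List.Properties as List
import Data.List.Relation.Unary.Any.Properties as Any
import Data.List.Relation.Unary.All.Properties as All
import Data.List.Relation.Unary.AllPairs.Properties as AllPairs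
open import Data.List.Relation.Unary.All as All using (All; []; _∷_)
open import Data.List.Relation.Unary.Any using (Any; here; there; any?; index)
open import Data.List.Relation.Unary.AllPairs using (AllPairs; []; _∷_)
open import Data.List.Relation.Unary.Unique.Propositional using (Unique)
import Data.List.Relation.Unary.Unique.Propositional.Properties as Unique
open import Data.Nat using (ℕ; suc; pred; _+_; _≤_; _<_; _%_; s≤s; z≤n)
open import Data.Nat.DivMod using (m<n⇒m%n≡m; n%n≡0)
import Data.Nat.Properties as ℕ
open import Data.Unit using (⊤; tt)
import Data.Product
open import Data.Product using (Σ; _×_; ∃; _,_; proj₁; proj₂)
import Data.Sum
open import Data.Sum using (_⊎_; inj₁; inj₂; swap; [_,_]′)
open import Data.Vec using ([]; _∷_)
import Data.Vec.Properties as Vec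
open import Function using (id; _∘_; _∘′_; case_of_)
open import Function.Bundles using (_⇔_; mk⇔; Equivalence)
open import Relation.Binary.PropositionalEquality
open import Relation.Nullary using (¬_; ¬?; Dec; yes; no)

open Equivalence using (to; from)

private variable
  m : ℕ

∣p∪q∣≤∣p∣+∣q∣ : (p q : Subset m) → ∣ p ∪ q ∣ ≤ ∣ p ∣ + ∣ q ∣
∣p∪q∣≤∣p∣+∣q∣ []         []          = z≤n
∣p∪q∣≤∣p∣+∣q∣ (true ∷ p)  (true ∷ q)  =
  s≤s (ℕ.≤-trans (∣p∪q∣≤∣p∣+∣q∣ p q) (ℕ.+-monoʳ-≤ ∣ p ∣ (ℕ.n≤1+n _)))
∣p∪q∣≤∣p∣+∣q∣ (true ∷ p)  (false ∷ q) = s≤s (∣p∪q∣≤∣p∣+∣q∣ p q)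
∣p∪q∣≤∣p∣+∣q∣ (false ∷ p) (true ∷ q)  =
  ℕ.≤-trans (s≤s (∣p∪q∣≤∣p∣+∣q∣ p q)) (ℕ.≤-reflexive (sym (ℕ.+-suc ∣ p ∣ ∣ q ∣)))
∣p∪q∣≤∣p∣+∣q∣ (false ∷ p) (false ∷ q) = ∣p∪q∣≤∣p∣+∣q∣ p q

fromList : List (Fin m) → Subset m
fromList = foldr (λ x s → ⁅ x ⁆ ∪ s) ∅

∈-fromList⁺ : {x : Fin m} {xs : List (Fin m)} → x ∈ₗ xs → x ∈ fromList xs
∈-fromList⁺ {xs = y ∷ _} (here refl) = x∈p∪q⁺ (inj₁ (x∈⁅x⁆ y))
∈-fromList⁺ (there x∈xs)              = x∈p∪q⁺ (inj₂ (∈-fromList⁺ x∈xs))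

∈-fromList⁻ : {x : Fin m} (xs : List (Fin m)) → x ∈ fromList xs → x ∈ₗ xs
∈-fromList⁻ []       x∈ = ⊥-elim (∉⊥ x∈)
∈-fromList⁻ (y ∷ ys) x∈ with x∈p∪q⁻ ⁅ y ⁆ (fromList ys) x∈
... | inj₁ x∈⁅y⁆ = here (x∈⁅y⁆⇒x≡y y x∈⁅y⁆)
... | inj₂ x∈ys  = there (∈-fromList⁻ ys x∈ys)

∣fromList∣≤length : (xs : List (Fin m)) → ∣ fromList xs ∣ ≤ length xs
∣fromList∣≤length {m} []  = ℕ.≤-reflexive (∣⊥∣≡0 m)
∣fromList∣≤length (y ∷ ys) = begin
  ∣ ⁅ y ⁆ ∪ fromList ys ∣      ≤⟨ ∣p∪q∣≤∣p∣+∣q∣ ⁅ y ⁆ (fromList ys) ⟩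
  ∣ ⁅ y ⁆ ∣ + ∣ fromList ys ∣  ≡⟨ cong (_+ ∣ fromList ys ∣) (∣⁅x⁆∣≡1 y) ⟩
  suc ∣ fromList ys ∣          ≤⟨ s≤s (∣fromList∣≤length ys) ⟩
  suc (length ys)              ∎
  where open ℕ.≤-Reasoning

∣p∣≤length : (p : Subset m) (xs : List (Fin m)) → (∀ {x} → x ∈ p → x ∈ₗ xs) → ∣ p ∣ ≤ length xs
∣p∣≤length p xs p⊆xs = ℕ.≤-trans (p⊆q⇒∣p∣≤∣q∣ (∈-fromList⁺ ∘′ p⊆xs)) (∣fromList∣≤length xs)

length≤∣p∣ : (p : Subset m) (xs : List (Fin m)) → Unique xs → (∀ {x} → x ∈ₗ xs → x ∈ p) → length xs ≤ ∣ p ∣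
length≤∣p∣ p []       _            _     = z≤n
length≤∣p∣ p (x ∷ xs) (x∉xs ∷ uxs) xs⊆p = ℕ.≤-trans
  (s≤s (length≤∣p∣ (p - x) xs uxs λ y∈xs →
         x∈p∧x≢y⇒x∈p-y (xs⊆p (there y∈xs)) (λ { refl → All.lookup x∉xs y∈xs refl })))
  (x∈p⇒∣p-x∣<∣p∣ (xs⊆p (here refl)))

∣fromList∣≡length : (xs : List (Fin m)) → Unique xs → ∣ fromList xs ∣ ≡ length xs
∣fromList∣≡length xs uxs = ℕ.≤-antisym (∣fromList∣≤length xs) (length≤∣p∣ (fromList xs) xs uxs ∈-fromList⁺)

∈⋃⁺ : {x : Fin m} {L : Subset m} {Ls : List (Subset m)} → L ∈ₗ Ls → x ∈ L → x ∈ ⋃ Ls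
∈⋃⁺ (here refl) x∈L = x∈p∪q⁺ (inj₁ x∈L)
∈⋃⁺ (there L∈Ls) x∈L = x∈p∪q⁺ (inj₂ (∈⋃⁺ L∈Ls x∈L))

∈⋃⁻ : {x : Fin m} (Ls : List (Subset m)) → x ∈ ⋃ Ls → ∃ λ L → L ∈ₗ Ls × x ∈ L
∈⋃⁻ []       x∈ = ⊥-elim (∉⊥ x∈)
∈⋃⁻ (L ∷ Ls) x∈ with x∈p∪q⁻ L (⋃ Ls) x∈
... | inj₁ x∈L = L , here refl , x∈L
... | inj₂ x∈⋃ with ∈⋃⁻ Ls x∈⋃
...   | L′ , L′∈Ls , x∈L′ = L′ , there L′∈Ls , x∈L′

lookup-injective : {A : Set} {xs : List A} → Unique xs → ∀ {i j} → List.lookup xs i ≡ List.lookup xs j → i ≡ j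
lookup-injective {xs = _ ∷ _} _ {Fin.zero} {Fin.zero} _ = refl
lookup-injective (x∉ ∷ _) {Fin.zero}  {Fin.suc j} eq = ⊥-elim (All.lookup x∉ (∈-lookup j) eq)
lookup-injective (x∉ ∷ _) {Fin.suc i} {Fin.zero}  eq = ⊥-elim (All.lookup x∉ (∈-lookup i) (sym eq))
lookup-injective (_ ∷ u)  {Fin.suc i} {Fin.suc j} eq = cong Fin.suc (lookup-injective u eq)

∈∉⇒≢ : {A : Set} {x y : A} {xs : List A} → x ∈ₗ xs → y ∉ₗ xs → x ≢ y
∈∉⇒≢ x∈ y∉ refl = y∉ x∈

fromℕ-or : ℕ → Fin m → Fin m
fromℕ-or {m} k d with k ℕ.<? m
... | yes k<m = fromℕ< k<m
... | no _    = d

fromℕ-or-toℕ : ∀ {k} (j d : Fin m) → toℕ j ≡ k → fromℕ-or k d ≡ j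
fromℕ-or-toℕ {m} j d refl with toℕ j ℕ.<? m
... | yes j<m = Fin.fromℕ<-toℕ j j<m
... | no j≮m  = ⊥-elim (j≮m (Fin.toℕ<n j))

module GraphFacts {n : ℕ} (G : Graph n) where
  open Graph G

  private variable
    u v w x y : Fin n
    A B L L′ S T : Subset n
    Ls Ms : List (Subset n)

  E-sym : E G u v → E G v u
  E-sym {u} {v} e = trans (adj-sym v u) e

  E-irrefl : ¬ E G v v
  E-irrefl {v} e with () ← trans (sym e) (irrefl v)

  E⇒≢ : E G u v → u ≢ v
  E⇒≢ e refl = E-irrefl e

  E? : ∀ u v → Dec (E G u v)
  E? u v = adj u v Bool.≟ true

  ∈N⁺ : E G v x → x ∈ N G v
  ∈N⁺ {v} {x} e = Vec.lookup⇒[]= x _ (trans (Vec.lookup∘tabulate (adj v) x) e)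

  ∈N⁻ : x ∈ N G v → E G v x
  ∈N⁻ {x} {v} x∈ = trans (sym (Vec.lookup∘tabulate (adj v) x)) (Vec.[]=⇒lookup x∈)

  Reach-source : Reach G S u v → u ∈ S
  Reach-source (here u∈) = u∈
  Reach-source (step u∈ _ _) = u∈

  Reach-target : Reach G S u v → v ∈ S
  Reach-target (here v∈) = v∈
  Reach-target (step _ _ r) = Reach-target r

  Reach-mono : S ⊆ T → Reach G S u v → Reach G T u v
  Reach-mono S⊆T (here u∈) = here (S⊆T u∈)
  Reach-mono S⊆T (step u∈ e r) = step (S⊆T u∈) e (Reach-mono S⊆T r)

  Reach-trans : Reach G S u v → Reach G S v w → Reach G S u w
  Reach-trans (here _) r′ = r′
  Reach-trans (step u∈ e r) r′ = step u∈ e (Reach-trans r r′)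

  Reach-snoc : Reach G S u v → E G v w → w ∈ S → Reach G S u w
  Reach-snoc r e w∈ = Reach-trans r (step (Reach-target r) e (here w∈))

  Reach-sym : Reach G S u v → Reach G S v u
  Reach-sym (here u∈) = here u∈
  Reach-sym (step u∈ e r) = Reach-snoc (Reach-sym r) (E-sym e) u∈

  ConnectedSet-∪ : ConnectedSet G L → ConnectedSet G L′ → v ∈ L → x ∈ L′ → E G v x → ConnectedSet G (L ∪ L′)
  ConnectedSet-∪ {L} {L′} {v} {x} (_ , reachL) (_ , reachL′) v∈L x∈L′ e =
    (v , x∈p∪q⁺ (inj₁ v∈L)) , λ a b a∈ b∈ → Reach-trans (toV a∈) (fromV b∈)
    where
    inL : L ⊆ L ∪ L′
    inL = p⊆p∪q L′
    inL′ : L′ ⊆ L ∪ L′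
    inL′ = q⊆p∪q L L′
    toV : ∀ {a} → a ∈ L ∪ L′ → Reach G (L ∪ L′) a v
    toV a∈ with x∈p∪q⁻ L L′ a∈
    ... | inj₁ a∈L  = Reach-mono inL (reachL _ v a∈L v∈L)
    ... | inj₂ a∈L′ = Reach-snoc (Reach-mono inL′ (reachL′ _ x a∈L′ x∈L′)) (E-sym e) (inL v∈L)
    fromV : ∀ {b} → b ∈ L ∪ L′ → Reach G (L ∪ L′) v b
    fromV b∈ with x∈p∪q⁻ L L′ b∈
    ... | inj₁ b∈L  = Reach-mono inL (reachL v _ v∈L b∈L)
    ... | inj₂ b∈L′ = step (inL v∈L) e (Reach-mono inL′ (reachL′ x _ x∈L′ b∈L′))

  Separated : Subset n → Subset n → Set
  Separated A B = ∀ {a b} → a ∈ A → b ∈ B → a ≢ b × ¬ E G a b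

  Separated⇒¬Reach : Separated A B → u ∈ A → v ∈ B → ¬ Reach G (A ∪ B) u v
  Separated⇒¬Reach sep u∈A v∈B (here _) = proj₁ (sep u∈A v∈B) refl
  Separated⇒¬Reach {A} {B} sep u∈A v∈B (step _ e r) with x∈p∪q⁻ A B (Reach-source r)
  ... | inj₁ w∈A = Separated⇒¬Reach sep w∈A v∈B r
  ... | inj₂ w∈B = proj₂ (sep u∈A w∈B) e

  Reach-closed : L ⊆ T → (∀ {a b} → a ∈ S → b ∈ T → E G a b → b ∈ S) → Reach G L u v → u ∈ S → v ∈ S
  Reach-closed L⊆T closed (here _) u∈S = u∈S
  Reach-closed L⊆T closed (step _ e r) u∈S = Reach-closed L⊆T closed r (closed u∈S (L⊆T (Reach-source r)) e)

  Reach-chain : ∀ {q} (f : Fin (suc q) → Fin n) → (∀ i → f i ∈ L) →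
                (∀ (i : Fin q) → E G (f (inject₁ i)) (f (Fin.suc i))) → ∀ j → Reach G L (f Fin.zero) (f j)
  Reach-chain f f∈L edge Fin.zero = here (f∈L Fin.zero)
  Reach-chain {q = suc q} f f∈L edge (Fin.suc j) =
    step (f∈L Fin.zero) (edge Fin.zero)
      (Reach-chain (λ i → f (Fin.suc i)) (λ i → f∈L (Fin.suc i)) (λ i → edge (Fin.suc i)) j)

  Nonempty-∣∣≡suc : ∀ {k} → ∣ L ∣ ≡ suc k → Nonempty L
  Nonempty-∣∣≡suc {L} eq with nonempty? L
  ... | yes ne = ne
  ... | no ¬ne with () ← trans (sym eq) (trans (cong ∣_∣ (Empty-unique ¬ne)) (∣⊥∣≡0 n))

  AVertex⇒ConnectedSet : AVertex G L → ConnectedSet G L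
  AVertex⇒ConnectedSet {L} (inj₁ ∣L∣≡1) = Nonempty-∣∣≡suc ∣L∣≡1 , reach
    where
    reach : ∀ x y → x ∈ L → y ∈ L → Reach G L x y
    reach x y x∈ y∈ with x Fin.≟ y
    ... | yes refl = here x∈
    ... | no x≢y with s≤s () ← ℕ.≤-trans (length≤∣p∣ L (x ∷ y ∷ []) ((x≢y ∷ []) ∷ [] ∷ [])
                                        λ { (here refl) → x∈ ; (there (here refl)) → y∈ })
                                      (ℕ.≤-reflexive ∣L∣≡1)
  AVertex⇒ConnectedSet {L} (inj₂ (inj₁ (∣L∣≡3 , complete))) = Nonempty-∣∣≡suc ∣L∣≡3 , reach
    where
    reach : ∀ x y → x ∈ L → y ∈ L → Reach G L x y
    reach x y x∈ y∈ with x Fin.≟ y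
    ... | yes refl = here x∈
    ... | no x≢y = step x∈ (complete x y x∈ y∈ x≢y) (here y∈)
  AVertex⇒ConnectedSet {L} (inj₂ (inj₂ (suc p , _ , f , _ , mem , adjP))) = (f Fin.zero , f∈L Fin.zero) , reach
    where
    f∈L : ∀ i → f i ∈ L
    f∈L i = from (mem (f i)) (i , refl)
    fromHead : ∀ j → Reach G L (f Fin.zero) (f j)
    fromHead = Reach-chain f f∈L λ i → from (adjP (inject₁ i) (Fin.suc i)) (inj₁ (cong suc (Fin.toℕ-inject₁ i)))
    reach : ∀ x y → x ∈ L → y ∈ L → Reach G L x y
    reach x y x∈ y∈ with to (mem x) x∈ | to (mem y) y∈
    ... | i , refl | j , refl = Reach-trans (Reach-sym (fromHead i)) (fromHead j)

  AVertex-degree≤2 : AVertex G L → v ∈ L → ∣ L ∩ N G v ∣ ≤ 2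
  AVertex-degree≤2 {L} {v} (inj₁ ∣L∣≡1) _ =
    ℕ.≤-trans (∣p∩q∣≤∣p∣ L (N G v)) (ℕ.≤-trans (ℕ.≤-reflexive ∣L∣≡1) (s≤s z≤n))
  AVertex-degree≤2 {L} {v} (inj₂ (inj₁ (∣L∣≡3 , _))) v∈L =
    ℕ.≤-pred (ℕ.≤-trans (s≤s (p⊆q⇒∣p∣≤∣q∣ nbrs⊆L-v)) (subst (∣ L - v ∣ <_) ∣L∣≡3 (x∈p⇒∣p-x∣<∣p∣ v∈L)))
    where
    nbrs⊆L-v : L ∩ N G v ⊆ L - v
    nbrs⊆L-v x∈ with x∈L , x∈N ← x∈p∩q⁻ L (N G v) x∈ = x∈p∧x≢y⇒x∈p-y x∈L (E⇒≢ (∈N⁻ x∈N) ∘ sym)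
  AVertex-degree≤2 {L} {v} (inj₂ (inj₂ (p , _ , f , _ , mem , adjP))) v∈L with to (mem v) v∈L
  ... | i , refl =
    ∣p∣≤length (L ∩ N G (f i)) (f (fromℕ-or (suc (toℕ i)) i) ∷ f (fromℕ-or (pred (toℕ i)) i) ∷ []) nbr
    where
    nbr : ∀ {x} → x ∈ L ∩ N G (f i) → x ∈ₗ _
    nbr x∈ with x∈p∩q⁻ L (N G (f i)) x∈
    ... | x∈L , x∈N with to (mem _) x∈L
    ... | j , refl with to (adjP i j) (∈N⁻ x∈N)
    ... | inj₁ next = here (cong f (sym (fromℕ-or-toℕ j i (sym next))))
    ... | inj₂ prev = there (here (cong f (sym (fromℕ-or-toℕ j i (cong pred prev)))))

  StableA-closed : StableA G Ls → L ∈ₗ Ls → x ∈ L → y ∈ ⋃ Ls → E G x y → y ∈ L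
  StableA-closed {Ls} {L} (_ , avs , stable) L∈Ls x∈L y∈⋃ e with ∈⋃⁻ Ls y∈⋃
  ... | L′ , L′∈Ls , y∈L′ with Vec.≡-dec Bool._≟_ L′ L
  ...   | yes refl = y∈L′
  ...   | no L′≢L = ⊥-elim (stable L L′ L∈Ls L′∈Ls (L′≢L ∘ sym , connected))
    where
    connected : ConnectedSet G (L ∪ L′)
    connected = ConnectedSet-∪ (AVertex⇒ConnectedSet (All.lookup avs L∈Ls))
                               (AVertex⇒ConnectedSet (All.lookup avs L′∈Ls)) x∈L y∈L′ e

  ⋃-Co3Plex : StableA G Ls → Co3Plex G (⋃ Ls)
  ⋃-Co3Plex {Ls} st@(_ , avs , _) v v∈⋃ with ∈⋃⁻ Ls v∈⋃
  ... | L , L∈Ls , v∈L = ℕ.≤-trans (p⊆q⇒∣p∣≤∣q∣ nbrs⊆) (AVertex-degree≤2 (All.lookup avs L∈Ls) v∈L)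
    where
    nbrs⊆ : ⋃ Ls ∩ N G v ⊆ L ∩ N G v
    nbrs⊆ x∈ with x∈⋃ , x∈N ← x∈p∩q⁻ (⋃ Ls) (N G v) x∈ =
      x∈p∩q⁺ (StableA-closed st L∈Ls v∈L x∈⋃ (∈N⁻ x∈N) , x∈N)

  ⋃-injective : StableA G Ls → StableA G Ms → ⋃ Ls ≡ ⋃ Ms → L ∈ₗ Ls → L ∈ₗ Ms
  ⋃-injective {Ls} {Ms} {L} stL@(_ , avsL , _) stM@(_ , avsM , _) eq L∈Ls
    with (u , u∈L) , reachL ← AVertex⇒ConnectedSet (All.lookup avsL L∈Ls)
    with M , M∈Ms , u∈M ← ∈⋃⁻ Ms (subst (u ∈_) eq (∈⋃⁺ L∈Ls u∈L)) = subst (_∈ₗ Ms) (sym L≡M) M∈Ms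
    where
    reachM = proj₂ (AVertex⇒ConnectedSet (All.lookup avsM M∈Ms))
    L≡M : L ≡ M
    L≡M = ⊆-antisym
      (λ x∈L → Reach-closed (λ y∈L → subst (_ ∈_) eq (∈⋃⁺ L∈Ls y∈L)) (StableA-closed stM M∈Ms)
                            (reachL u _ u∈L x∈L) u∈M)
      (λ x∈M → Reach-closed (λ y∈M → subst (_ ∈_) (sym eq) (∈⋃⁺ M∈Ms y∈M)) (StableA-closed stL L∈Ls)
                            (reachM u _ u∈M x∈M) u∈L)

%-step : ∀ {a k} → a < k →
         (suc a < k × suc (suc a) % suc k ≡ suc (suc a)) ⊎ (suc a ≡ k × suc (suc a) % suc k ≡ 0)
%-step {a} a<k with ℕ.m≤n⇒m<n∨m≡n a<k
... | inj₁ 1+a<k = inj₁ (1+a<k , m<n⇒m%n≡m (s≤s 1+a<k))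
... | inj₂ refl  = inj₂ (refl , n%n≡0 (suc (suc a)))

%-step-≡suc : ∀ {a b k} → a < k → b < k → suc (suc a) % suc k ≡ suc b ⇔ suc a ≡ b
%-step-≡suc {a} {b} a<k b<k with %-step a<k
... | inj₁ (_ , eq)     = mk⇔ (ℕ.suc-injective ∘ trans (sym eq)) (trans eq ∘ cong suc)
... | inj₂ (refl , eq) = mk⇔ (λ eq′ → ⊥-elim (ℕ.1+n≢0 (sym (trans (sym eq) eq′))))
                              (λ { refl → ⊥-elim (ℕ.<-irrefl refl b<k) })

%-step-≡0 : ∀ {a k} → a < k → suc (suc a) % suc k ≡ 0 ⇔ suc a ≡ k
%-step-≡0 a<k with %-step a<k
... | inj₁ (1+a<k , eq) = mk⇔ (λ eq′ → ⊥-elim (ℕ.1+n≢0 (trans (sym eq) eq′)))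
                              (λ { refl → ⊥-elim (ℕ.<-irrefl refl 1+a<k) })
... | inj₂ (1+a≡k , eq) = mk⇔ (λ _ → 1+a≡k) (λ _ → eq)

module InducedPaths {n : ℕ} (G : Graph n) where
  open GraphFacts G

  private variable
    w x : Fin n
    xs ys t : List (Fin n)

  HeadAdjacent : Fin n → List (Fin n) → Set
  HeadAdjacent x []      = ⊤
  HeadAdjacent x (y ∷ _) = E G x y

  InducedPath : List (Fin n) → Set
  InducedPath []       = ⊤
  InducedPath (x ∷ xs) = x ∉ₗ xs × HeadAdjacent x xs × All (¬_ ∘ E G x) (List.drop 1 xs) × InducedPath xs

  InducedPath⇒Unique : InducedPath xs → Unique xs
  InducedPath⇒Unique {[]}     _                   = []
  InducedPath⇒Unique {x ∷ xs} (x∉xs , _ , _ , ind) = All.¬Any⇒All¬ xs x∉xs ∷ InducedPath⇒Unique ind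

  InducedPath-head : InducedPath (x ∷ xs) → ∀ j → E G x (List.lookup xs j) ⇔ toℕ j ≡ 0
  InducedPath-head {xs = _ ∷ _} (_ , x~y , _ , _) Fin.zero    = mk⇔ (λ _ → refl) (λ _ → x~y)
  InducedPath-head {xs = _ ∷ _} (_ , _ , x≁ , _)  (Fin.suc j) = mk⇔ (⊥-elim ∘ All.lookup x≁ (∈-lookup j)) λ ()

  InducedPath-lookup : InducedPath xs → ∀ i j → E G (List.lookup xs i) (List.lookup xs j) ⇔ PathAdj G (length xs) i j
  InducedPath-lookup {x ∷ xs} _ Fin.zero Fin.zero = mk⇔ (⊥-elim ∘ E-irrefl) λ { (inj₁ ()) ; (inj₂ ()) }
  InducedPath-lookup {x ∷ xs} ind Fin.zero (Fin.suc j) =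
    mk⇔ (λ e → inj₁ (cong suc (sym (to (InducedPath-head ind j) e))))
        λ { (inj₁ eq) → from (InducedPath-head ind j) (sym (ℕ.suc-injective eq)) ; (inj₂ ()) }
  InducedPath-lookup {x ∷ xs} ind (Fin.suc i) Fin.zero =
    mk⇔ (swap ∘ to (InducedPath-lookup ind Fin.zero (Fin.suc i)) ∘ E-sym)
        (E-sym ∘ from (InducedPath-lookup ind Fin.zero (Fin.suc i)) ∘ swap)
  InducedPath-lookup {x ∷ xs} (_ , _ , _ , ind) (Fin.suc i) (Fin.suc j) =
    mk⇔ (Data.Sum.map (cong suc) (cong suc) ∘ to (InducedPath-lookup ind i j))
        (from (InducedPath-lookup ind i j) ∘ Data.Sum.map ℕ.suc-injective ℕ.suc-injective)

  InducedPath-ʳ++ : ∀ a as → InducedPath (a ∷ as) → InducedPath ys → HeadAdjacent a ys →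
                    (∀ {z} → z ∈ₗ a ∷ as → z ∉ₗ ys) → (∀ {z w} → z ∈ₗ as → w ∈ₗ ys → ¬ E G z w) →
                    All (¬_ ∘ E G a) (List.drop 1 ys) → InducedPath ((a ∷ as) ʳ++ ys)
  InducedPath-ʳ++ a [] _ indYs a~ys disjoint _ a≁ys = disjoint (here refl) , a~ys , a≁ys , indYs
  InducedPath-ʳ++ {ys} a (b ∷ bs) (a∉ , a~b , a≁ , indBs) indYs a~ys disjoint noEdges a≁ys =
    InducedPath-ʳ++ b bs indBs (disjoint (here refl) , a~ys , a≁ys , indYs) (E-sym a~b) disjoint′ noEdges′
      (All.tabulate (noEdges (here refl)))
    where
    disjoint′ : ∀ {z} → z ∈ₗ b ∷ bs → z ∉ₗ a ∷ ys
    disjoint′ z∈ (here refl)  = a∉ z∈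
    disjoint′ z∈ (there z∈ys) = disjoint (there z∈) z∈ys
    noEdges′ : ∀ {z w} → z ∈ₗ bs → w ∈ₗ a ∷ ys → ¬ E G z w
    noEdges′ z∈ (here refl) e = All.lookup a≁ z∈ (E-sym e)
    noEdges′ z∈ (there w∈)    = noEdges (there z∈) w∈

  InducedPath-reverse : InducedPath xs → InducedPath (List.reverse xs)
  InducedPath-reverse {[]}     _   = tt
  InducedPath-reverse {a ∷ as} ind = InducedPath-ʳ++ a as ind tt tt (λ _ ()) (λ _ ()) []

  data Position (w : Fin n) (ys : List (Fin n)) : Set where
    first : ys ≡ w ∷ t → Position w ys
    last  : ys ≡ t ∷ʳ w → Position w ys
    inner : ∀ {a b} → a ∈ₗ ys → b ∈ₗ ys → a ≢ b → E G w a → E G w b → Position w ys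

  position : InducedPath ys → w ∈ₗ ys → Position w ys
  position {y ∷ ys} _ (here refl) = first refl
  position {y ∷ ys} (y∉ , y~ , _ , ind) (there w∈) with position ind w∈
  ... | first {[]} refl    = last {t = y ∷ []} refl
  ... | first {_ ∷ _} refl = inner (here refl) (there (there (here refl))) (λ { refl → y∉ (there (here refl)) })
                                   (E-sym y~) (proj₁ (proj₂ ind))
  ... | last {t} refl      = last {t = y ∷ t} refl
  ... | inner a∈ b∈ a≢b e e′ = inner (there a∈) (there b∈) a≢b e e′

  orient : InducedPath ys → ys ≡ t ∷ʳ w → ∃ λ t′ → InducedPath (w ∷ t′) × (∀ {z} → z ∈ₗ w ∷ t′ ⇔ z ∈ₗ ys)
  orient {t = t} {w} ind refl =
    List.reverse t , subst InducedPath reversed (InducedPath-reverse ind) ,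
    mk⇔ (λ z∈ → Any.reverse⁻ (subst (_ ∈ₗ_) (sym reversed) z∈))
        (λ z∈ → subst (_ ∈ₗ_) reversed (Any.reverse⁺ z∈))
    where
    reversed : List.reverse (t ∷ʳ w) ≡ w ∷ List.reverse t
    reversed = List.reverse-++ t (w ∷ [])

  lookup-head : Unique (w ∷ t) → ∀ j → List.lookup (w ∷ t) j ≡ w ⇔ toℕ j ≡ 0
  lookup-head _          Fin.zero    = mk⇔ (λ _ → refl) (λ _ → refl)
  lookup-head (w∉ ∷ _) (Fin.suc j) = mk⇔ (⊥-elim ∘ All.lookup w∉ (∈-lookup j) ∘ sym) λ ()

  lookup-last : ys ≡ t ∷ʳ w → Unique ys → ∀ j → List.lookup ys j ≡ w ⇔ suc (toℕ j) ≡ length ys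
  lookup-last {t = []}    refl _        Fin.zero    = mk⇔ (λ _ → refl) (λ _ → refl)
  lookup-last {t = y ∷ t} {w} refl (y∉ ∷ _) Fin.zero =
    mk⇔ (⊥-elim ∘ All.lookup y∉ (∈-++⁺ʳ t (here refl)))
        (λ eq → ⊥-elim (ℕ.1+n≢0 (sym (trans (ℕ.suc-injective eq) length-∷ʳ))))
    where
    length-∷ʳ : length (t ∷ʳ w) ≡ suc (length t)
    length-∷ʳ = trans (List.length-++ t) (ℕ.+-comm (length t) 1)
  lookup-last {t = y ∷ t} refl (_ ∷ u)  (Fin.suc j) =
    mk⇔ (cong suc ∘ to (lookup-last refl u j)) (from (lookup-last refl u j) ∘ ℕ.suc-injective)

  cycle-adjacency : ∀ x ys → 2 ≤ length ys → InducedPath ys →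
    (∀ j → E G x (List.lookup ys j) ⇔ (toℕ j ≡ 0 ⊎ suc (toℕ j) ≡ length ys)) →
    ∀ i j → E G (List.lookup (x ∷ ys) i) (List.lookup (x ∷ ys) j) ⇔ CycAdj G (length ys) i j
  cycle-adjacency x ys 2≤k ind x~ = adjacency
    where
    k = length ys
    1%k+1≡1 : 1 % suc k ≡ 1
    1%k+1≡1 = m<n⇒m%n≡m (s≤s (ℕ.≤-trans (s≤s z≤n) 2≤k))
    fromX : ∀ j → E G x (List.lookup ys j) ⇔ CycAdj G k Fin.zero (Fin.suc j)
    fromX j = mk⇔
      (Data.Sum.map (λ j≡0 → trans 1%k+1≡1 (cong suc (sym j≡0))) (from (%-step-≡0 (Fin.toℕ<n j))) ∘ to (x~ j))
      (from (x~ j) ∘ Data.Sum.map (λ eq → sym (ℕ.suc-injective (trans (sym 1%k+1≡1) eq))) (to (%-step-≡0 (Fin.toℕ<n j))))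
    adjacency : ∀ i j → E G (List.lookup (x ∷ ys) i) (List.lookup (x ∷ ys) j) ⇔ CycAdj G k i j
    adjacency Fin.zero    Fin.zero    =
      mk⇔ (⊥-elim ∘ E-irrefl) λ c → ⊥-elim (ℕ.1+n≢0 (trans (sym 1%k+1≡1) ([ id , id ]′ c)))
    adjacency Fin.zero    (Fin.suc j) = fromX j
    adjacency (Fin.suc i) Fin.zero    = mk⇔ (swap ∘ to (fromX i) ∘ E-sym) (E-sym ∘ from (fromX i) ∘ swap)
    adjacency (Fin.suc i) (Fin.suc j) = mk⇔
      (Data.Sum.map (from (%-step-≡suc i<k j<k)) (from (%-step-≡suc j<k i<k)) ∘ to (InducedPath-lookup ind i j))
      (from (InducedPath-lookup ind i j) ∘ Data.Sum.map (to (%-step-≡suc i<k j<k)) (to (%-step-≡suc j<k i<k)))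
      where
      i<k = Fin.toℕ<n i
      j<k = Fin.toℕ<n j

  Chordal⇒¬closable : ∀ {w b c rest} → Chordal G → InducedPath (w ∷ b ∷ c ∷ rest) → x ∉ₗ w ∷ b ∷ c ∷ rest →
    (∀ j → E G x (List.lookup (w ∷ b ∷ c ∷ rest) j) ⇔ (toℕ j ≡ 0 ⊎ suc (toℕ j) ≡ length (w ∷ b ∷ c ∷ rest))) → ⊥
  Chordal⇒¬closable {x} {w} {b} {c} {rest} chordal ind x∉ x~ =
    chordal (length rest) (List.lookup (x ∷ w ∷ b ∷ c ∷ rest))
      (lookup-injective (All.¬Any⇒All¬ _ x∉ ∷ InducedPath⇒Unique ind))
      (cycle-adjacency x (w ∷ b ∷ c ∷ rest) (s≤s (s≤s z≤n)) ind x~)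

module Components {n : ℕ} (G : Graph n) (chordal : Chordal G) (S : Subset n) (co3 : Co3Plex G S) where
  open GraphFacts G
  open InducedPaths G

  private variable
    a b c v w x : Fin n
    t xs ys ys₁ ys₂ : List (Fin n)

  InS : List (Fin n) → Set
  InS xs = ∀ {v} → v ∈ₗ xs → v ∈ S

  ¬three-neighbours : w ∈ S → a ∈ S → b ∈ S → c ∈ S → a ≢ b → a ≢ c → b ≢ c →
                      E G w a → E G w b → E G w c → ⊥
  ¬three-neighbours {w} {a} {b} {c} w∈ a∈ b∈ c∈ a≢b a≢c b≢c w~a w~b w~c =
    ℕ.≤⇒≯ (ℕ.≤-trans (length≤∣p∣ (S ∩ N G w) (a ∷ b ∷ c ∷ []) distinct nbr) (co3 w w∈)) (ℕ.n<1+n 2)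
    where
    distinct : Unique (a ∷ b ∷ c ∷ [])
    distinct = (a≢b ∷ a≢c ∷ []) ∷ (b≢c ∷ []) ∷ [] ∷ []
    nbr : ∀ {z} → z ∈ₗ a ∷ b ∷ c ∷ [] → z ∈ S ∩ N G w
    nbr (here refl)                 = x∈p∩q⁺ (a∈ , ∈N⁺ w~a)
    nbr (there (here refl))         = x∈p∩q⁺ (b∈ , ∈N⁺ w~b)
    nbr (there (there (here refl))) = x∈p∩q⁺ (c∈ , ∈N⁺ w~c)

  touch-endpoint : InducedPath ys → InS ys → x ∈ S → x ∉ₗ ys → w ∈ₗ ys → E G x w →
                   ∃ λ t → InducedPath (w ∷ t) × (∀ {z} → z ∈ₗ w ∷ t ⇔ z ∈ₗ ys)
  touch-endpoint ind inS x∈ x∉ w∈ x~w with position ind w∈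
  ... | first refl = _ , ind , mk⇔ id id
  ... | last eq    = orient ind eq
  ... | inner a∈ b∈ a≢b w~a w~b = ⊥-elim (¬three-neighbours (inS w∈) (inS a∈) (inS b∈) x∈ a≢b
                                    (∈∉⇒≢ a∈ x∉) (∈∉⇒≢ b∈ x∉) w~a w~b (E-sym x~w))

  -- The one place where chordality is used: otherwise x would close an induced path of length ≥ 3 into a hole.
  closing-neighbour : InducedPath (w ∷ t) → InS (w ∷ t) → x ∈ S → x ∉ₗ w ∷ t →
                      E G x w → v ∈ₗ t → E G x v → t ≡ v ∷ []
  closing-neighbour {t = c ∷ []} _ _ _ _ _ (here refl) _ = refl
  closing-neighbour {w = w} {t = c ∷ d ∷ rest} {x = x} {v = v} ind inS x∈ x∉ x~w v∈t x~v
    with position ind (there v∈t)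
  ... | first refl = ⊥-elim (proj₁ ind v∈t)
  ... | inner a∈ b∈ a≢b v~a v~b = ⊥-elim (¬three-neighbours (inS (there v∈t)) (inS a∈) (inS b∈) x∈ a≢b
                                    (∈∉⇒≢ a∈ x∉) (∈∉⇒≢ b∈ x∉) v~a v~b (E-sym x~v))
  ... | last path≡t′∷ʳv = ⊥-elim (Chordal⇒¬closable chordal ind x∉ x~ends)
    where
    zs = w ∷ c ∷ d ∷ rest
    unique = InducedPath⇒Unique ind
    w≢v : w ≢ v
    w≢v refl = proj₁ ind v∈t
    x~ends : ∀ j → E G x (List.lookup zs j) ⇔ (toℕ j ≡ 0 ⊎ suc (toℕ j) ≡ length zs)
    x~ends j = mk⇔ onlyEnds λ
      { (inj₁ j≡0)    → subst (E G x) (sym (from (lookup-head unique j) j≡0)) x~w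
      ; (inj₂ j-last) → subst (E G x) (sym (from (lookup-last path≡t′∷ʳv unique j) j-last)) x~v }
      where
      onlyEnds : E G x (List.lookup zs j) → toℕ j ≡ 0 ⊎ suc (toℕ j) ≡ length zs
      onlyEnds x~z with List.lookup zs j Fin.≟ w | List.lookup zs j Fin.≟ v
      ... | yes z≡w | _       = inj₁ (to (lookup-head unique j) z≡w)
      ... | no _    | yes z≡v = inj₂ (to (lookup-last path≡t′∷ʳv unique j) z≡v)
      ... | no z≢w  | no z≢v  = ⊥-elim (¬three-neighbours x∈ (inS (here refl)) (inS (there v∈t)) (inS (∈-lookup j))
                                   w≢v (z≢w ∘ sym) (z≢v ∘ sym) x~w x~v x~z)

  data Piece : Set where
    path     : List (Fin n) → Piece
    triangle : Fin n → Fin n → Fin n → Piece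

  vertices : Piece → List (Fin n)
  vertices (path xs)        = xs
  vertices (triangle a b c) = a ∷ b ∷ c ∷ []

  WellFormed : Piece → Set
  WellFormed (path xs)        = (∃ λ v → v ∈ₗ xs) × InducedPath xs
  WellFormed (triangle a b c) = a ≢ b × a ≢ c × b ≢ c × E G a b × E G a c × E G b c

  Apart : Piece → Piece → Set
  Apart P Q = ∀ {x y} → x ∈ₗ vertices P → y ∈ₗ vertices Q → x ≢ y × ¬ E G x y

  infix 4 _∈ₚ_
  _∈ₚ_ : Fin n → List Piece → Set
  v ∈ₚ Ps = Any (λ P → v ∈ₗ vertices P) Ps

  Touches : Fin n → Piece → Set
  Touches x P = Any (E G x) (vertices P)

  Merges : Fin n → List Piece → Piece → Set
  Merges x Ts Q = WellFormed Q × (∀ {v} → v ∈ₗ vertices Q ⇔ (v ≡ x ⊎ v ∈ₚ Ts))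

  private variable
    P Q : Piece
    Ps Ts : List Piece

  Apart-sym : Apart P Q → Apart Q P
  Apart-sym apart x∈ y∈ = let y≢x , y≁x = apart y∈ x∈ in y≢x ∘ sym , y≁x ∘ E-sym

  ≡⊎Apart : AllPairs Apart Ps → P ∈ₗ Ps → Q ∈ₗ Ps → P ≡ Q ⊎ Apart P Q
  ≡⊎Apart (_ ∷ _)      (here refl) (here refl) = inj₁ refl
  ≡⊎Apart (apart ∷ _)  (here refl) (there Q∈)  = inj₂ (All.lookup apart Q∈)
  ≡⊎Apart {P = P} {Q} (apart ∷ _) (there P∈) (here refl) = inj₂ (Apart-sym {Q} {P} (All.lookup apart P∈))
  ≡⊎Apart (_ ∷ aparts) (there P∈)  (there Q∈)  = ≡⊎Apart aparts P∈ Q∈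

  triangle-untouched : WellFormed (triangle a b c) → InS (a ∷ b ∷ c ∷ []) → x ∈ S → x ∉ₗ a ∷ b ∷ c ∷ [] →
                       ¬ Touches x (triangle a b c)
  triangle-untouched {a} {b} {c} {x} (a≢b , a≢c , b≢c , a~b , a~c , b~c) inS x∈ x∉ touch = corner (find touch)
    where
    a∈ : a ∈ₗ a ∷ b ∷ c ∷ []
    a∈ = here refl
    b∈ : b ∈ₗ a ∷ b ∷ c ∷ []
    b∈ = there (here refl)
    c∈ : c ∈ₗ a ∷ b ∷ c ∷ []
    c∈ = there (there (here refl))
    ≢x : ∀ {z} → z ∈ₗ a ∷ b ∷ c ∷ [] → z ≢ x
    ≢x z∈ = ∈∉⇒≢ z∈ x∉
    corner : (∃ λ z → z ∈ₗ a ∷ b ∷ c ∷ [] × E G x z) → ⊥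
    corner (_ , here refl , x~a) =
      ¬three-neighbours (inS a∈) (inS b∈) (inS c∈) x∈ b≢c (≢x b∈) (≢x c∈) a~b a~c (E-sym x~a)
    corner (_ , there (here refl) , x~b) =
      ¬three-neighbours (inS b∈) (inS a∈) (inS c∈) x∈ a≢c (≢x a∈) (≢x c∈) (E-sym a~b) b~c (E-sym x~b)
    corner (_ , there (there (here refl)) , x~c) =
      ¬three-neighbours (inS c∈) (inS a∈) (inS b∈) x∈ a≢b (≢x a∈) (≢x b∈) (E-sym a~c) (E-sym b~c) (E-sym x~c)

  cons-merges : (∀ {z} → z ∈ₗ xs ⇔ z ∈ₗ vertices P) → ∀ {z} → z ∈ₗ x ∷ xs ⇔ (z ≡ x ⊎ z ∈ₚ (P ∷ []))
  cons-merges same = mk⇔ (λ { (here eq) → inj₁ eq ; (there z∈) → inj₂ (here (to same z∈)) })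
                         (λ { (inj₁ eq) → here eq ; (inj₂ (here z∈)) → there (from same z∈) })

  extend : x ∈ S → x ∉ₗ vertices P → WellFormed P → InS (vertices P) → Touches x P → Σ Piece (Merges x (P ∷ []))
  extend {P = triangle a b c} x∈ x∉ wf inS touch = ⊥-elim (triangle-untouched wf inS x∈ x∉ touch)
  extend {x = x} {P = path ys} x∈ x∉ (_ , ind) inS touch with find touch
  ... | w , w∈ , x~w with touch-endpoint ind inS x∈ x∉ w∈ x~w
  ...   | t , indWt , same with any? (E? x) t
  ...     | no x≁t =
    path (x ∷ w ∷ t) , ((x , here refl) , (x∉ ∘ to same , x~w , All.¬Any⇒All¬ t x≁t , indWt)) , cons-merges same
  ...     | yes x~t with find x~t
  ...       | v , v∈t , x~v with closing-neighbour indWt (inS ∘′ to same) x∈ (x∉ ∘ to same) x~w v∈t x~v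
  ...         | refl = triangle x w v , (x≢w , x≢v , w≢v , x~w , x~v , proj₁ (proj₂ indWt)) , cons-merges same
    where
    x≢w : x ≢ w
    x≢w refl = x∉ (to same (here refl))
    x≢v : x ≢ v
    x≢v refl = x∉ (to same (there (here refl)))
    w≢v : w ≢ v
    w≢v refl = proj₁ indWt (here refl)

  join : x ∈ S → x ∉ₗ ys₁ → x ∉ₗ ys₂ → InducedPath ys₁ → InducedPath ys₂ → Apart (path ys₁) (path ys₂) →
         InS ys₁ → InS ys₂ → Touches x (path ys₁) → Touches x (path ys₂) →
         Σ Piece (Merges x (path ys₁ ∷ path ys₂ ∷ []))
  join {x} {ys₁} {ys₂} x∈ x∉₁ x∉₂ ind₁ ind₂ apart inS₁ inS₂ touch₁ touch₂
    with w₁ , w₁∈ , x~w₁ ← find touch₁ | w₂ , w₂∈ , x~w₂ ← find touch₂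
    with t₁ , indWt₁ , same₁ ← touch-endpoint ind₁ inS₁ x∈ x∉₁ w₁∈ x~w₁
       | t₂ , indWt₂ , same₂ ← touch-endpoint ind₂ inS₂ x∈ x∉₂ w₂∈ x~w₂
    = path ((w₁ ∷ t₁) ʳ++ (x ∷ w₂ ∷ t₂)) , ((x , Any.reverseAcc⁺ _ (w₁ ∷ t₁) (inj₁ (here refl))) , joined) , merged
    where
    apart′ : ∀ {y z} → y ∈ₗ w₁ ∷ t₁ → z ∈ₗ w₂ ∷ t₂ → y ≢ z × ¬ E G y z
    apart′ y∈ z∈ = apart (to same₁ y∈) (to same₂ z∈)
    w₁≢w₂ : w₁ ≢ w₂
    w₁≢w₂ = proj₁ (apart′ (here refl) (here refl))
    x≁t₁ : ∀ {z} → z ∈ₗ t₁ → ¬ E G x z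
    x≁t₁ z∈ = ¬three-neighbours x∈ (inS₁ w₁∈) (inS₂ w₂∈) (inS₁ (to same₁ (there z∈))) w₁≢w₂
                (∈∉⇒≢ z∈ (proj₁ indWt₁) ∘ sym) (proj₁ (apart′ (there z∈) (here refl)) ∘ sym) x~w₁ x~w₂
    x≁t₂ : ∀ {z} → z ∈ₗ t₂ → ¬ E G x z
    x≁t₂ z∈ = ¬three-neighbours x∈ (inS₁ w₁∈) (inS₂ w₂∈) (inS₂ (to same₂ (there z∈))) w₁≢w₂
                (proj₁ (apart′ (here refl) (there z∈))) (∈∉⇒≢ z∈ (proj₁ indWt₂) ∘ sym) x~w₁ x~w₂
    disjoint : ∀ {z} → z ∈ₗ w₁ ∷ t₁ → z ∉ₗ x ∷ w₂ ∷ t₂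
    disjoint z∈ (here refl)  = x∉₁ (to same₁ z∈)
    disjoint z∈ (there z∈₂) = proj₁ (apart′ z∈ z∈₂) refl
    noEdges : ∀ {y z} → y ∈ₗ t₁ → z ∈ₗ x ∷ w₂ ∷ t₂ → ¬ E G y z
    noEdges y∈ (here refl) = x≁t₁ y∈ ∘ E-sym
    noEdges y∈ (there z∈)  = proj₂ (apart′ (there y∈) z∈)
    joined : InducedPath ((w₁ ∷ t₁) ʳ++ (x ∷ w₂ ∷ t₂))
    joined = InducedPath-ʳ++ w₁ t₁ indWt₁ (x∉₂ ∘ to same₂ , x~w₂ , All.tabulate x≁t₂ , indWt₂) (E-sym x~w₁)
               disjoint noEdges (All.tabulate (proj₂ ∘ apart′ (here refl)))
    merged : ∀ {z} → z ∈ₗ (w₁ ∷ t₁) ʳ++ (x ∷ w₂ ∷ t₂) ⇔ (z ≡ x ⊎ z ∈ₚ (path ys₁ ∷ path ys₂ ∷ []))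
    merged = mk⇔
      (λ z∈ → case Any.reverseAcc⁻ (x ∷ w₂ ∷ t₂) (w₁ ∷ t₁) z∈ of λ
         { (inj₁ (here z≡x))  → inj₁ z≡x
         ; (inj₁ (there z∈₂)) → inj₂ (there (here (to same₂ z∈₂)))
         ; (inj₂ z∈₁)         → inj₂ (here (to same₁ z∈₁)) })
      (λ { (inj₁ z≡x)                → Any.reverseAcc⁺ _ (w₁ ∷ t₁) (inj₁ (here z≡x))
         ; (inj₂ (here z∈₁))         → Any.reverseAcc⁺ _ (w₁ ∷ t₁) (inj₂ (from same₁ z∈₁))
         ; (inj₂ (there (here z∈₂))) → Any.reverseAcc⁺ _ (w₁ ∷ t₁) (inj₁ (there (from same₂ z∈₂)))
         ; (inj₂ (there (there ()))) })

  merge : x ∈ S → ¬ x ∈ₚ Ts → All WellFormed Ts → AllPairs Apart Ts → (∀ {v} → v ∈ₚ Ts → v ∈ S) →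
          All (Touches x) Ts → Σ Piece (Merges x Ts)
  merge {x} {[]} _ _ _ _ _ _ =
    path (x ∷ []) , ((x , here refl) , ((λ ()) , tt , [] , tt)) ,
    mk⇔ (λ { (here eq) → inj₁ eq }) (λ { (inj₁ eq) → here eq ; (inj₂ ()) })
  merge {Ts = P ∷ []} x∈ x∉ (wf ∷ []) _ inS (touch ∷ []) =
    extend x∈ (x∉ ∘ here) wf (λ v∈ → inS (here v∈)) touch
  merge {Ts = triangle a b c ∷ _ ∷ []} x∈ x∉ (wf ∷ _) _ inS (touch ∷ _) =
    ⊥-elim (triangle-untouched wf (λ v∈ → inS (here v∈)) x∈ (x∉ ∘ here) touch)
  merge {Ts = path _ ∷ triangle a b c ∷ []} x∈ x∉ (_ ∷ wf ∷ []) _ inS (_ ∷ touch ∷ []) =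
    ⊥-elim (triangle-untouched wf (λ v∈ → inS (there (here v∈))) x∈ (x∉ ∘ there ∘ here) touch)
  merge {Ts = path _ ∷ path _ ∷ []} x∈ x∉ ((_ , ind₁) ∷ (_ , ind₂) ∷ []) ((apart ∷ []) ∷ _) inS (touch₁ ∷ touch₂ ∷ []) =
    join x∈ (x∉ ∘ here) (x∉ ∘ there ∘ here) ind₁ ind₂ apart
         (λ v∈ → inS (here v∈)) (λ v∈ → inS (there (here v∈))) touch₁ touch₂
  merge {Ts = _ ∷ _ ∷ _ ∷ _} x∈ _ _ ((PQ ∷ PR ∷ _) ∷ (QR ∷ _) ∷ _) inS (tP ∷ tQ ∷ tR ∷ _)
    with a , a∈ , x~a ← find tP | b , b∈ , x~b ← find tQ | c , c∈ , x~c ← find tR =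
    ⊥-elim (¬three-neighbours x∈ (inS (here a∈)) (inS (there (here b∈))) (inS (there (there (here c∈))))
      (proj₁ (PQ a∈ b∈)) (proj₁ (PR a∈ c∈)) (proj₁ (QR b∈ c∈)) x~a x~b x~c)

  Decomposition : List Piece → (Fin n → Set) → Set
  Decomposition Ps Member = All WellFormed Ps × AllPairs Apart Ps × (∀ {v} → v ∈ₚ Ps ⇔ Member v)

  insert : x ∈ S → ¬ x ∈ₚ Ps → All WellFormed Ps → AllPairs Apart Ps → (∀ {v} → v ∈ₚ Ps → v ∈ S) →
           Σ (List Piece) λ Ps′ → Decomposition Ps′ (λ v → v ≡ x ⊎ v ∈ₚ Ps)
  insert {x} {Ps} x∈ x∉ wfs aparts inS =
    new ∷ untouched , wfNew ∷ All.filter⁺ ¬T? wfs , All.tabulate new-apart ∷ AllPairs.filter⁺ ¬T? aparts ,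
    mk⇔ to′ from′
    where
    T? : ∀ P → Dec (Touches x P)
    T? P = any? (E? x) (vertices P)
    ¬T? : ∀ P → Dec (¬ Touches x P)
    ¬T? = ¬? ∘ T?
    untouched = List.filter ¬T? Ps
    merged = merge x∈ (x∉ ∘ Any.filter⁻ T?) (All.filter⁺ T? wfs) (AllPairs.filter⁺ T? aparts) (inS ∘′ Any.filter⁻ T?)
                   (All.all-filter T? Ps)
    new = proj₁ merged
    wfNew = proj₁ (proj₂ merged)
    sameNew = proj₂ (proj₂ merged)
    new-apart : ∀ {R} → R ∈ₗ untouched → Apart new R
    new-apart {R} R∈ a∈ b∈ with R∈Ps , ¬tR ← ∈-filter⁻ ¬T? {xs = Ps} R∈ with to sameNew a∈
    ... | inj₁ refl = (λ { refl → x∉ (lose R∈Ps b∈) }) , ¬tR ∘ lose b∈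
    ... | inj₂ a∈touched
      with P , P∈ , a∈P ← find a∈touched
      with P∈Ps , tP ← ∈-filter⁻ T? {xs = Ps} P∈
      with ≡⊎Apart aparts P∈Ps R∈Ps
    ...   | inj₁ refl  = ⊥-elim (¬tR tP)
    ...   | inj₂ apart = apart a∈P b∈
    to′ : ∀ {v} → v ∈ₚ new ∷ untouched → v ≡ x ⊎ v ∈ₚ Ps
    to′ (here v∈new) = Data.Sum.map₂ (Any.filter⁻ T?) (to sameNew v∈new)
    to′ (there v∈) = inj₂ (Any.filter⁻ ¬T? v∈)
    from′ : ∀ {v} → v ≡ x ⊎ v ∈ₚ Ps → v ∈ₚ new ∷ untouched
    from′ (inj₁ v≡x) = here (from sameNew (inj₁ v≡x))
    from′ (inj₂ v∈) with P , P∈Ps , v∈P ← find v∈ with T? P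
    ... | yes tP = here (from sameNew (inj₂ (lose (∈-filter⁺ T? P∈Ps tP) v∈P)))
    ... | no ¬tP = there (lose (∈-filter⁺ ¬T? P∈Ps ¬tP) v∈P)

  pieces : ∀ vs → Unique vs → Σ (List Piece) λ Ps → Decomposition Ps (λ v → v ∈ S × v ∈ₗ vs)
  pieces [] _ = [] , [] , [] , mk⇔ (λ ()) (λ ())
  pieces (x ∷ vs) (x∉vs ∷ unique) with pieces vs unique
  ... | Ps , wfs , aparts , same with x ∈? S
  ... | no x∉S = Ps , wfs , aparts , mk⇔ (Data.Product.map₂ there ∘ to same) λ
          { (x∈S , here refl)   → ⊥-elim (x∉S x∈S)
          ; (v∈S , there v∈vs) → from same (v∈S , v∈vs) }
  ... | yes x∈S = add-x (insert x∈S x∉Ps wfs aparts (proj₁ ∘ to same))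
    where
    x∉Ps : ¬ x ∈ₚ Ps
    x∉Ps x∈ = All.lookup x∉vs (proj₂ (to same x∈)) refl
    add-x : (Σ (List Piece) λ Ps′ → Decomposition Ps′ (λ v → v ≡ x ⊎ v ∈ₚ Ps)) →
            Σ (List Piece) λ Ps′ → Decomposition Ps′ (λ v → v ∈ S × v ∈ₗ x ∷ vs)
    add-x (Ps′ , wfs′ , aparts′ , same′) = Ps′ , wfs′ , aparts′ , mk⇔ to′ from′
      where
      to′ : ∀ {v} → v ∈ₚ Ps′ → v ∈ S × v ∈ₗ x ∷ vs
      to′ v∈ with to same′ v∈
      ... | inj₁ refl = x∈S , here refl
      ... | inj₂ v∈Ps = Data.Product.map₂ there (to same v∈Ps)
      from′ : ∀ {v} → v ∈ S × v ∈ₗ x ∷ vs → v ∈ₚ Ps′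
      from′ (_ , here v≡x)      = from same′ (inj₁ v≡x)
      from′ (v∈S , there v∈vs) = from same′ (inj₂ (from same (v∈S , v∈vs)))

  vertexSet : Piece → Subset n
  vertexSet = fromList ∘ vertices

  nonempty : WellFormed P → ∃ λ v → v ∈ₗ vertices P
  nonempty {path _}           (v∈ , _) = v∈
  nonempty {triangle a _ _} _        = a , here refl

  WellFormed⇒AVertex : WellFormed P → AVertex G (vertexSet P)
  WellFormed⇒AVertex {path (x ∷ [])} (_ , ind) = inj₁ (∣fromList∣≡length _ (InducedPath⇒Unique ind))
  WellFormed⇒AVertex {path xs@(_ ∷ _ ∷ _)} (_ , ind) =
    inj₂ (inj₂ (length xs , s≤s (s≤s z≤n) , List.lookup xs , lookup-injective (InducedPath⇒Unique ind) ,
                 (λ v → mk⇔ (position-of ∘ ∈-fromList⁻ xs) λ { (i , refl) → ∈-fromList⁺ (∈-lookup {xs = xs} i) }) ,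
                 InducedPath-lookup ind))
    where
    position-of : ∀ {v} → v ∈ₗ xs → ∃ λ i → List.lookup xs i ≡ v
    position-of v∈ = index v∈ , sym (Any.lookup-index v∈)
  WellFormed⇒AVertex {triangle a b c} (a≢b , a≢c , b≢c , a~b , a~c , b~c) =
    inj₂ (inj₁ (∣fromList∣≡length _ ((a≢b ∷ a≢c ∷ []) ∷ (b≢c ∷ []) ∷ [] ∷ []) ,
                λ u v u∈ v∈ → adjacent (∈-fromList⁻ _ u∈) (∈-fromList⁻ _ v∈)))
    where
    adjacent : ∀ {u v} → u ∈ₗ a ∷ b ∷ c ∷ [] → v ∈ₗ a ∷ b ∷ c ∷ [] → u ≢ v → E G u v
    adjacent (here refl)                 (there (here refl))         _ = a~b
    adjacent (here refl)                 (there (there (here refl))) _ = a~c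
    adjacent (there (here refl))         (there (there (here refl))) _ = b~c
    adjacent (there (here refl))         (here refl)                 _ = E-sym a~b
    adjacent (there (there (here refl))) (here refl)                 _ = E-sym a~c
    adjacent (there (there (here refl))) (there (here refl))         _ = E-sym b~c
    adjacent (here refl)                 (here refl)                 u≢v = ⊥-elim (u≢v refl)
    adjacent (there (here refl))         (there (here refl))         u≢v = ⊥-elim (u≢v refl)
    adjacent (there (there (here refl))) (there (there (here refl))) u≢v = ⊥-elim (u≢v refl)

  Apart⇒Separated : Apart P Q → Separated (vertexSet P) (vertexSet Q)
  Apart⇒Separated apart x∈ y∈ = apart (∈-fromList⁻ _ x∈) (∈-fromList⁻ _ y∈)

  Apart⇒≢ : WellFormed P → Apart P Q → vertexSet P ≢ vertexSet Q
  Apart⇒≢ {P} {Q} wf apart eq with a , a∈ ← nonempty wf =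
    proj₁ (apart a∈ (∈-fromList⁻ (vertices Q) (subst (a ∈_) eq (∈-fromList⁺ a∈)))) refl

  distinct : All WellFormed Ps → AllPairs Apart Ps → AllPairs (λ P Q → vertexSet P ≢ vertexSet Q) Ps
  distinct []          []              = []
  distinct (wf ∷ wfs) (apart ∷ aparts) = All.map (λ {R} → Apart⇒≢ {Q = R} wf) apart ∷ distinct wfs aparts

  Co3Plex⇒StableA : Σ (List (Subset n)) λ Ls → StableA G Ls × ⋃ Ls ≡ S
  Co3Plex⇒StableA with Ps , wfs , aparts , same ← pieces (List.allFin n) (Unique.allFin⁺ n) =
    List.map vertexSet Ps ,
    (AllPairs.map⁺ (distinct wfs aparts) , All.map⁺ (All.map WellFormed⇒AVertex wfs) , nonadjacent) ,
    ⊆-antisym ⋃⊆S S⊆⋃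
    where
    nonadjacent : ∀ L L′ → L ∈ₗ List.map vertexSet Ps → L′ ∈ₗ List.map vertexSet Ps → ¬ AAdj G L L′
    nonadjacent _ _ L∈ L′∈ (L≢L′ , connected) with ∈-map⁻ vertexSet L∈ | ∈-map⁻ vertexSet L′∈
    ... | P′ , P′∈ , refl | Q′ , Q′∈ , refl with ≡⊎Apart aparts P′∈ Q′∈
    ...   | inj₁ refl  = L≢L′ refl
    ...   | inj₂ apart with nonempty (All.lookup wfs P′∈) | nonempty (All.lookup wfs Q′∈)
    ...     | a , a∈ | b , b∈ =
      Separated⇒¬Reach (Apart⇒Separated {P′} {Q′} apart) (∈-fromList⁺ a∈) (∈-fromList⁺ b∈)
        (proj₂ connected a b (x∈p∪q⁺ (inj₁ (∈-fromList⁺ a∈))) (x∈p∪q⁺ (inj₂ (∈-fromList⁺ b∈))))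
    ⋃⊆S : ⋃ (List.map vertexSet Ps) ⊆ S
    ⋃⊆S x∈ with L , L∈ , x∈L ← ∈⋃⁻ (List.map vertexSet Ps) x∈ with P′ , P′∈ , refl ← ∈-map⁻ vertexSet L∈ =
      proj₁ (to same (lose P′∈ (∈-fromList⁻ _ x∈L)))
    S⊆⋃ : S ⊆ ⋃ (List.map vertexSet Ps)
    S⊆⋃ {x} x∈ with P′ , P′∈ , x∈P′ ← find (from same (x∈ , ∈-allFin x)) =
      ∈⋃⁺ (∈-map⁺ vertexSet P′∈) (∈-fromList⁺ x∈P′)

mainTheorem1 : ∀ {n : ℕ} (G : Graph n) → Connected G → Chordal G →
    ((Ls : List (Subset n)) → StableA G Ls → Co3Plex G (⋃ Ls)) ×
    ((S : Subset n) → Co3Plex G S → Σ (List (Subset n)) λ Ls → StableA G Ls × ⋃ Ls ≡ S) ×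
    ((Ls Ms : List (Subset n)) → StableA G Ls → StableA G Ms → ⋃ Ls ≡ ⋃ Ms → Ls ≈ₛ Ms)
mainTheorem1 G _ chordal =
  (λ _ → ⋃-Co3Plex) ,
  (λ S co3 → Components.Co3Plex⇒StableA G chordal S co3) ,
  λ _ _ stL stM eq L → mk⇔ (⋃-injective stL stM eq) (⋃-injective stM stL (sym eq))
  where open GraphFacts G
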